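{- Let $p$ be a prime and let $A \subseteq \mathbb{N} = \{1,2,\ldots\}$, with ratio set $R(A) = \{a/a' : a,a' \in A\}$. (a) If $A$ is $p$-adically dense in $\mathbb{N}$, then $R(A)$ is dense in $\mathbb{Q}_p$. (b) If $R(A)$ is $p$-adically dense in $\mathbb{N}$, then $R(A)$ is dense in $\mathbb{Q}_p$.
   Context: A set $X \subseteq \mathbb{Q}$ is $p$-adically dense in $\mathbb{N}$ if every $n \in \mathbb{N}$ is a limit, in the $p$-adic metric $d(x,y)=|x-y|_p$, of elements of $X$; i.e., for every $n \in \mathbb{N}$ and every $r \geq 1$ there is $x \in X$ with $\nu_p(x-n) \geq r$. $\mathbb{Q}_p$ denotes the field of $p$-adic numbers. -}

module Defs where

open import Data.Nat as ℕ using (ℕ; suc; _^_; _≥_)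
open import Data.Nat.Divisibility using (_∣_)
open import Data.Integer using (ℤ; +_)
open import Data.Rational using (ℚ; _/_; _-_; _*_)
open import Data.Product using (Σ; ∃; ∃-syntax; _×_)
open import Relation.Nullary using (¬_)
open import Relation.Binary.PropositionalEquality using (_≡_)

SubsetℕOf : Set₁
SubsetℕOf = ℕ → Set

Subsetℚ : Set₁
Subsetℚ = ℚ → Set

-- ν_p(x - y) ≥ r  (for x, y ∈ ℚ, r ∈ ℕ):
-- (x - y) = p^r * (a / b) with a ∈ ℤ, b ∈ ℕ, b ≠ 0 and p ∤ b
-- (covers x = y via a = 0, matching ν_p(0) = ∞).
pClose : (p r : ℕ) → ℚ → ℚ → Set
pClose p r x y =
  ∃[ a ] ∃[ b ] (¬ (p ∣ suc b)) × ((x - y) * ((+ suc b) / 1) ≡ ((+ (p ^ r)) / 1) * (a / 1))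

toℚSet : SubsetℕOf → Subsetℚ
toℚSet A x = ∃[ n ] A n × (x ≡ (+ n) / 1)

-- Ratio set R(A) = { a / a' : a, a' ∈ A }  (A ⊆ {1,2,...}, so a' = suc k).
R : SubsetℕOf → Subsetℚ
R A x = ∃[ a ] ∃[ k ] A a × A (suc k) × (x ≡ (+ a) / suc k)

pDenseInℕ : ℕ → Subsetℚ → Set
pDenseInℕ p X = (n : ℕ) → n ≥ 1 → (r : ℕ) → r ≥ 1 →
  ∃[ x ] X x × pClose p r x ((+ n) / 1)

-- Since ℚ is dense in ℚ_p
-- and p-adic balls are centred at any of their points, it suffices (and is
-- equivalent) to take balls with rational centres q and radius p^{-r}.
pDenseInQp : ℕ → Subsetℚ → Set
pDenseInQp p X = (q : ℚ) → (r : ℕ) → ∃[ x ] X x × pClose p r x q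

{-# OPTIONS --safe #-}
-- Let ℤ₍ₚ₎ ⊆ ℚ be the rationals whose denominator is prime to p, so that
-- pClose p r x y says x − y ∈ p ^ r ℤ₍ₚ₎. Every element of ℤ₍ₚ₎ is congruent
-- modulo p ^ r to a positive integer (invert the denominator modulo p ^ r), so a
-- set approximating all positive integers approximates all of ℤ₍ₚ₎. If the
-- reduced fraction q = u / d is not in ℤ₍ₚ₎ then p ∤ u, so 1 / q ∈ ℤ₍ₚ₎ and
-- p ^ e q ∈ ℤ₍ₚ₎ for some e; approximating 1 / q by x ∈ R(A) to precision
-- r + 2e + 1 makes 1 / x ∈ R(A) approximate q to precision r, because
-- 1 / x − q = q (1 / x) (1 / q − x). For (a), a ≈ n and a′ ≈ 1 with a, a′ ∈ A
-- give a / a′ ≈ n, since a′ is then a unit of ℤ₍ₚ₎.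
module Submission where

open import Defs
open import Data.Nat using (ℕ; _≥_)
open import Data.Nat.Primality using (Prime)
open import Data.Product using (_×_)

open import Level using (0ℓ)
open import Data.Nat as ℕ using (suc; zero; _^_; s≤s; z≤n)
import Data.Nat.Properties as ℕ
open import Data.Nat.Coprimality as Coprimality using (Coprime; coprime-Bézout; coprime-divisor)
open import Data.Nat.Divisibility using (_∣_; _∣?_; divides; _∣0; ∣1⇒≡1; ∣-refl; ∣-trans)
open import Data.Nat.GCD using (module Bézout)
open import Data.Nat.Induction using (<-rec)
open import Data.Nat.Primality using (euclidsLemma; ¬prime[1]; prime⇒irreducible; prime⇒nonZero; prime⇒nonTrivial)
open import Data.Nat.Tactic.RingSolver as ℕ-Solver using ()
open import Data.Integer as ℤ using (ℤ; +_; -[1+_]; +[1+_])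
import Data.Integer.Properties as ℤ
import Data.Integer.Divisibility.Signed as ℤ
open import Data.Integer.DivMod using (_%ℕ_; _/ℕ_; a≡a%ℕn+[a/ℕn]*n)
open import Data.Integer.Tactic.RingSolver as ℤ-Solver using ()
open import Data.Rational as ℚ using (ℚ; mkℚ; _/_; _+_; _-_; _*_; -_; 1ℚ; 0ℚ; toℚᵘ)
import Data.Rational.Properties as ℚ
open import Data.Rational.Unnormalised as ℚᵘ using (mkℚᵘ; *≡*)
import Data.Rational.Unnormalised.Properties as ℚᵘ
open import Data.Product using (∃-syntax; _,_)
open import Data.Sum using ([_,_]; inj₁; inj₂)
open import Data.Empty using (⊥-elim)
open import Relation.Nullary using (¬_; Dec; yes; no)
open import Relation.Nullary.Decidable.Core using (dec⇒maybe)
open import Relation.Binary.PropositionalEquality hiding ([_])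
open ≡-Reasoning
import Tactic.RingSolver as Solver
open import Tactic.RingSolver.Core.AlmostCommutativeRing using (AlmostCommutativeRing; fromCommutativeRing)

ℚ-ring : AlmostCommutativeRing 0ℓ 0ℓ
ℚ-ring = fromCommutativeRing ℚ.+-*-commutativeRing (λ x → dec⇒maybe (0ℚ ℚ.≟ x))

ι : ℤ → ℚ
ι i = i / 1

-- Identities between fractions are proved in ℚᵘ, where _/_ does not normalise.
toℚᵘ-/ : ∀ i n → toℚᵘ (i / suc n) ℚᵘ.≃ mkℚᵘ i n
toℚᵘ-/ i n = ℚ.toℚᵘ-fromℚᵘ (mkℚᵘ i n)

ι-* : ∀ i j → ι (i ℤ.* j) ≡ ι i * ι j
ι-* i j = ℚ.toℚᵘ-injective (ℚᵘ.≃-trans (toℚᵘ-/ (i ℤ.* j) 0) (ℚᵘ.≃-sym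
  (ℚᵘ.≃-trans (ℚ.toℚᵘ-homo-* (ι i) (ι j)) (ℚᵘ.*-cong (toℚᵘ-/ i 0) (toℚᵘ-/ j 0)))))

ι-+ : ∀ i j → ι (i ℤ.+ j) ≡ ι i + ι j
ι-+ i j = ℚ.toℚᵘ-injective (ℚᵘ.≃-trans (toℚᵘ-/ (i ℤ.+ j) 0) (ℚᵘ.≃-sym
  (ℚᵘ.≃-trans (ℚ.toℚᵘ-homo-+ (ι i) (ι j))
    (ℚᵘ.≃-trans (ℚᵘ.+-cong (toℚᵘ-/ i 0) (toℚᵘ-/ j 0)) (*≡* (eq i j))))))
  where
  eq : ∀ i j → (i ℤ.* + 1 ℤ.+ j ℤ.* + 1) ℤ.* + 1 ≡ (i ℤ.+ j) ℤ.* + 1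
  eq = ℤ-Solver.solve-∀

ι-neg : ∀ i → ι (ℤ.- i) ≡ - ι i
ι-neg i = ℚ.toℚᵘ-injective (ℚᵘ.≃-trans (toℚᵘ-/ (ℤ.- i) 0) (ℚᵘ.≃-sym
  (ℚᵘ.≃-trans (ℚ.toℚᵘ-homo‿- (ι i)) (ℚᵘ.-‿cong (toℚᵘ-/ i 0)))))

ι-ℕ-* : ∀ m n → ι (+ (m ℕ.* n)) ≡ ι (+ m) * ι (+ n)
ι-ℕ-* m n = trans (cong ι (ℤ.pos-* m n)) (ι-* (+ m) (+ n))

ι-^-+ : ∀ m a b → ι (+ m ^ (a ℕ.+ b)) ≡ ι (+ m ^ a) * ι (+ m ^ b)
ι-^-+ m a b = trans (cong (λ k → ι (+ k)) (ℕ.^-distribˡ-+-* m a b)) (ι-ℕ-* (m ^ a) (m ^ b))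

/-*-ι : ∀ i n → (i / suc n) * ι (+ suc n) ≡ ι i
/-*-ι i n = ℚ.toℚᵘ-injective (ℚᵘ.≃-trans (ℚ.toℚᵘ-homo-* (i / suc n) (ι (+ suc n)))
  (ℚᵘ.≃-trans (ℚᵘ.*-cong (toℚᵘ-/ i n) (toℚᵘ-/ (+ suc n) 0)) (ℚᵘ.≃-sym (ℚᵘ.≃-trans (toℚᵘ-/ i 0)
    (*≡* (trans (cong (i ℤ.*_) (ℤ.pos-* (suc n) 1)) (sym (ℤ.*-assoc i (+ suc n) (+ 1)))))))))

*-denominator : ∀ q → q * ι (ℚ.↧ q) ≡ ι (ℚ.↥ q)
*-denominator q@(mkℚ u d _) = trans (cong (_* ι (+ suc d)) (sym (ℚ.↥p/↧p≡p q))) (/-*-ι u d)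

/-≡-ι-* : ∀ i n → i / suc n ≡ ι i * (+ 1 / suc n)
/-≡-ι-* i n = ℚ.toℚᵘ-injective (ℚᵘ.≃-trans (toℚᵘ-/ i n) (ℚᵘ.≃-sym
  (ℚᵘ.≃-trans (ℚ.toℚᵘ-homo-* (ι i) (+ 1 / suc n)) (ℚᵘ.≃-trans (ℚᵘ.*-cong (toℚᵘ-/ i 0) (toℚᵘ-/ (+ 1) n))
    (*≡* (cong₂ (λ j m → j ℤ.* + m) (ℤ.*-identityʳ i) (sym (ℕ.*-identityˡ (suc n)))))))))

/-*-/ : ∀ m n → (+ suc m / suc n) * (+ suc n / suc m) ≡ 1ℚ
/-*-/ m n = ℚ.toℚᵘ-injective (ℚᵘ.≃-trans (ℚ.toℚᵘ-homo-* (+ suc m / suc n) (+ suc n / suc m))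
  (ℚᵘ.≃-trans (ℚᵘ.*-cong (toℚᵘ-/ (+ suc m) n) (toℚᵘ-/ (+ suc n) m))
    (*≡* (trans (ℤ.*-identityʳ _) (trans (cong +_ (ℕ.*-comm (suc m) (suc n))) (sym (ℤ.*-identityˡ _)))))))

R-inverse : ∀ {A} → (∀ a → A a → a ≥ 1) → ∀ {x} → R A x → ∃[ x̃ ] R A x̃ × x̃ * x ≡ 1ℚ
R-inverse A⁺ (zero  , k , 0∈A , _ , _) with A⁺ 0 0∈A
... | ()
R-inverse A⁺ (suc a , k , a+1∈A , k+1∈A , refl) = + suc k / suc a , (suc k , a , k+1∈A , a+1∈A , refl) , /-*-/ k a

integral-inverse-identity : ∀ x x̃ y ỹ q b b′ a a′ s p → x̃ * x ≡ 1ℚ → ỹ * y ≡ 1ℚ →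
                            q * ỹ * b′ ≡ a′ → (x - y) * b ≡ q * (p * s) * a →
                            q * x̃ * (b * b′ + a′ * s * a * p) ≡ b * a′
integral-inverse-identity x x̃ y ỹ q b b′ a a′ s p x̃x≡1 ỹy≡1 a′-eq x-y-eq = begin
  q * x̃ * (b * b′ + a′ * s * a * p)
    ≡⟨ cong (λ t → q * x̃ * (b * b′ + t * s * a * p)) a′-eq ⟨
  q * x̃ * (b * b′ + q * ỹ * b′ * s * a * p)
    ≡⟨ factor q x̃ b b′ ỹ s a p ⟩
  q * x̃ * b′ * (b + ỹ * (q * (p * s) * a))
    ≡⟨ cong (λ t → q * x̃ * b′ * (b + ỹ * t)) x-y-eq ⟨
  q * x̃ * b′ * (b + ỹ * ((x - y) * b))
    ≡⟨ expand q x̃ b′ b ỹ x y ⟩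
  q * ỹ * b′ * b * (x̃ * x) + q * x̃ * b′ * b * (1ℚ - ỹ * y)
    ≡⟨ cong₂ (λ u v → q * ỹ * b′ * b * u + q * x̃ * b′ * b * (1ℚ - v)) x̃x≡1 ỹy≡1 ⟩
  q * ỹ * b′ * b * 1ℚ + q * x̃ * b′ * b * (1ℚ - 1ℚ)
    ≡⟨ collapse q ỹ b′ b x̃ ⟩
  b * (q * ỹ * b′)
    ≡⟨ cong (b *_) a′-eq ⟩
  b * a′
    ∎
  where
  factor : ∀ q x̃ b b′ ỹ s a p →
           q * x̃ * (b * b′ + q * ỹ * b′ * s * a * p) ≡ q * x̃ * b′ * (b + ỹ * (q * (p * s) * a))
  factor = Solver.solve-∀ ℚ-ring
  expand : ∀ q x̃ b′ b ỹ x y →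
           q * x̃ * b′ * (b + ỹ * ((x - y) * b)) ≡ q * ỹ * b′ * b * (x̃ * x) + q * x̃ * b′ * b * (1ℚ - ỹ * y)
  expand = Solver.solve-∀ ℚ-ring
  collapse : ∀ q ỹ b′ b x̃ → q * ỹ * b′ * b * 1ℚ + q * x̃ * b′ * b * (1ℚ - 1ℚ) ≡ b * (q * ỹ * b′)
  collapse = Solver.solve-∀ ℚ-ring

positive-representative : ∀ i n .{{_ : ℕ.NonZero n}} → ∃[ m ] m ≥ 1 × ∃[ k ] + m ≡ i ℤ.+ + n ℤ.* k
positive-representative i n = i %ℕ n ℕ.+ n , ℕ.≤-trans (ℕ.>-nonZero⁻¹ n) (ℕ.m≤n+m n (i %ℕ n)) ,
  + 1 ℤ.- i /ℕ n , (begin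
    + (i %ℕ n ℕ.+ n)
      ≡⟨ ℤ.pos-+ (i %ℕ n) n ⟩
    + (i %ℕ n) ℤ.+ + n
      ≡⟨ shift (+ (i %ℕ n)) (i /ℕ n) (+ n) ⟩
    + (i %ℕ n) ℤ.+ i /ℕ n ℤ.* + n ℤ.+ + n ℤ.* (+ 1 ℤ.- i /ℕ n)
      ≡⟨ cong (λ j → j ℤ.+ + n ℤ.* (+ 1 ℤ.- i /ℕ n)) (a≡a%ℕn+[a/ℕn]*n i n) ⟨
    i ℤ.+ + n ℤ.* (+ 1 ℤ.- i /ℕ n)
      ∎)
  where
  shift : ∀ r q n → r ℤ.+ n ≡ r ℤ.+ q ℤ.* n ℤ.+ n ℤ.* (+ 1 ℤ.- q)
  shift = ℤ-Solver.solve-∀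

module PAdic (p : ℕ) (p-prime : Prime p) where

  p∤1 : ¬ p ∣ 1
  p∤1 p∣1 = ¬prime[1] (subst Prime (∣1⇒≡1 p∣1) p-prime)

  ∤-* : ∀ i j → ¬ p ∣ ℤ.∣ i ∣ → ¬ p ∣ ℤ.∣ j ∣ → ¬ p ∣ ℤ.∣ i ℤ.* j ∣
  ∤-* i j p∤i p∤j p∣ij = [ p∤i , p∤j ] (euclidsLemma _ _ p-prime (subst (p ∣_) (ℤ.abs-* i j) p∣ij))

  ∤-+-* : ∀ i j → ¬ p ∣ ℤ.∣ i ∣ → ¬ p ∣ ℤ.∣ i ℤ.+ j ℤ.* + p ∣
  ∤-+-* i j p∤i p∣i+jp =
    p∤i (ℤ.∣⇒∣ᵤ {+ p} {i}
      (ℤ.∣m+n∣n⇒∣m (ℤ.∣ᵤ⇒∣ {+ p} {i ℤ.+ j ℤ.* + p} p∣i+jp) (ℤ.∣n⇒∣m*n j ℤ.∣-refl)))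

  ∤⇒coprime : ∀ {n} → ¬ p ∣ n → Coprime n p
  ∤⇒coprime p∤n (d∣n , d∣p) with prime⇒irreducible p-prime d∣p
  ... | inj₁ d≡1 = d≡1
  ... | inj₂ refl = ⊥-elim (p∤n d∣n)

  ∤⇒coprime-^ : ∀ {n} → ¬ p ∣ n → ∀ r → Coprime n (p ^ r)
  ∤⇒coprime-^ p∤n zero    (_ , d∣1) = ∣1⇒≡1 d∣1
  ∤⇒coprime-^ p∤n (suc r) (d∣n , d∣pʳ⁺¹) =
    ∤⇒coprime-^ p∤n r
      (d∣n , coprime-divisor (λ (k∣d , k∣p) → ∤⇒coprime p∤n (∣-trans k∣d d∣n , k∣p)) d∣pʳ⁺¹)

  inverse-mod-^ : ∀ {n} → ¬ p ∣ n → ∀ r → ∃[ s ] ∃[ t ] s ℤ.* + n ≡ + 1 ℤ.+ + p ^ r ℤ.* t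
  inverse-mod-^ {n} p∤n r with coprime-Bézout (∤⇒coprime-^ p∤n r)
  ... | Bézout.+- x y eq = + x , + y , (begin
    + x ℤ.* + n              ≡⟨ ℤ.pos-* x n ⟨
    + (x ℕ.* n)              ≡⟨ cong +_ eq ⟨
    + (1 ℕ.+ y ℕ.* p ^ r)    ≡⟨ cong (λ k → + 1 ℤ.+ k) (trans (ℤ.pos-* y (p ^ r)) (ℤ.*-comm (+ y) (+ p ^ r))) ⟩
    + 1 ℤ.+ + p ^ r ℤ.* + y  ∎)
  ... | Bézout.-+ x y eq = ℤ.- + x , ℤ.- + y , (begin
    ℤ.- + x ℤ.* + n               ≡⟨ move (+ x) (+ n) ⟩
    + 1 ℤ.- (+ 1 ℤ.+ + x ℤ.* + n)  ≡⟨ cong (λ k → + 1 ℤ.- (+ 1 ℤ.+ k)) (ℤ.pos-* x n) ⟨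
    + 1 ℤ.- + (1 ℕ.+ x ℕ.* n)      ≡⟨ cong (λ k → + 1 ℤ.- + k) eq ⟩
    + 1 ℤ.- + (y ℕ.* p ^ r)        ≡⟨ cong (λ k → + 1 ℤ.- k) (ℤ.pos-* y (p ^ r)) ⟩
    + 1 ℤ.- + y ℤ.* + p ^ r        ≡⟨ flip (+ y) (+ p ^ r) ⟩
    + 1 ℤ.+ + p ^ r ℤ.* ℤ.- + y    ∎)
    where
    move : ∀ x n → ℤ.- x ℤ.* n ≡ + 1 ℤ.- (+ 1 ℤ.+ x ℤ.* n)
    move = ℤ-Solver.solve-∀
    flip : ∀ y P → + 1 ℤ.- y ℤ.* P ≡ + 1 ℤ.+ P ℤ.* ℤ.- y
    flip = ℤ-Solver.solve-∀

  congruence-solution : ∀ {n} → ¬ p ∣ n → ∀ a r → ∃[ m ] m ≥ 1 × ∃[ c ] + m ℤ.* + n ℤ.- a ≡ + p ^ r ℤ.* c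
  congruence-solution {n} p∤n a r =
    let s , t , sn≡1+pʳt = inverse-mod-^ p∤n r
        m , m≥1 , k , m≡sa+pʳk = positive-representative (s ℤ.* a) (p ^ r) {{ℕ.m^n≢0 p r {{prime⇒nonZero p-prime}}}}
    in m , m≥1 , a ℤ.* t ℤ.+ k ℤ.* + n , (begin
      + m ℤ.* + n ℤ.- a
        ≡⟨ cong (λ j → j ℤ.* + n ℤ.- a) m≡sa+pʳk ⟩
      (s ℤ.* a ℤ.+ P ℤ.* k) ℤ.* + n ℤ.- a
        ≡⟨ expand s a P k (+ n) ⟩
      a ℤ.* (s ℤ.* + n) ℤ.+ P ℤ.* (k ℤ.* + n) ℤ.- a
        ≡⟨ cong (λ j → a ℤ.* j ℤ.+ P ℤ.* (k ℤ.* + n) ℤ.- a) sn≡1+pʳt ⟩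
      a ℤ.* (+ 1 ℤ.+ P ℤ.* t) ℤ.+ P ℤ.* (k ℤ.* + n) ℤ.- a
        ≡⟨ collect a P t k (+ n) ⟩
      P ℤ.* (a ℤ.* t ℤ.+ k ℤ.* + n)
        ∎)
    where
    P = + p ^ r
    expand : ∀ s a P k n → (s ℤ.* a ℤ.+ P ℤ.* k) ℤ.* n ℤ.- a ≡ a ℤ.* (s ℤ.* n) ℤ.+ P ℤ.* (k ℤ.* n) ℤ.- a
    expand = ℤ-Solver.solve-∀
    collect : ∀ a P t k n → a ℤ.* (+ 1 ℤ.+ P ℤ.* t) ℤ.+ P ℤ.* (k ℤ.* n) ℤ.- a ≡ P ℤ.* (a ℤ.* t ℤ.+ k ℤ.* n)
    collect = ℤ-Solver.solve-∀

  factor-p-power : ∀ n → ∃[ e ] ∃[ w ] suc n ≡ p ^ e ℕ.* w × ¬ p ∣ w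
  factor-p-power = <-rec (λ n → ∃[ e ] ∃[ w ] suc n ≡ p ^ e ℕ.* w × ¬ p ∣ w) split
    where
    split : ∀ n → (∀ {m} → m ℕ.< n → ∃[ e ] ∃[ w ] suc m ≡ p ^ e ℕ.* w × ¬ p ∣ w) →
            ∃[ e ] ∃[ w ] suc n ≡ p ^ e ℕ.* w × ¬ p ∣ w
    split n rec with p ∣? suc n
    ... | no p∤n+1 = 0 , suc n , sym (ℕ.*-identityˡ (suc n)) , p∤n+1
    ... | yes (divides (suc q) n+1≡q+1*p) =
      let e , w , q+1≡pᵉw , p∤w = rec q<n in suc e , w , (begin
        suc n              ≡⟨ n+1≡q+1*p ⟩
        suc q ℕ.* p        ≡⟨ cong (ℕ._* p) q+1≡pᵉw ⟩
        p ^ e ℕ.* w ℕ.* p  ≡⟨ rotate (p ^ e) w p ⟩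
        p ℕ.* p ^ e ℕ.* w  ∎) , p∤w
      where
      q<n : q ℕ.< n
      q<n = ℕ.s<s⁻¹ (subst (suc q ℕ.<_) (sym n+1≡q+1*p)
              (ℕ.m<m*n (suc q) p (ℕ.nonTrivial⇒n>1 p {{prime⇒nonTrivial p-prime}})))
      rotate : ∀ a b c → a ℕ.* b ℕ.* c ≡ c ℕ.* a ℕ.* b
      rotate = ℕ-Solver.solve-∀

  infix 4 _∣ₚ_ _≈[_]_

  -- c ∣ₚ z means z ∈ c ℤ₍ₚ₎, with the witness in the shape used by pClose.
  -- It is a data type (and _≈[_]_ a record) so that their indices can be
  -- inferred by unification, which fails on the normalising _/_ inside pClose.
  data _∣ₚ_ (c z : ℚ) : Set where
    multiple : ∀ a b → ¬ p ∣ suc b → z * ι (+ suc b) ≡ c * ι a → c ∣ₚ z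

  record _≈[_]_ (x : ℚ) (r : ℕ) (y : ℚ) : Set where
    constructor close
    field difference : ι (+ p ^ r) ∣ₚ x - y

  Integral : ℚ → Set
  Integral = 1ℚ ∣ₚ_

  pClose⇒≈ : ∀ r x y → pClose p r x y → x ≈[ r ] y
  pClose⇒≈ _ _ _ (a , b , p∤b , eq) = close (multiple a b p∤b eq)

  ≈⇒pClose : ∀ {r x y} → x ≈[ r ] y → pClose p r x y
  ≈⇒pClose (close (multiple a b p∤b eq)) = a , b , p∤b , eq

  ∣ₚ-intro : ∀ {c z} b a → ¬ p ∣ ℤ.∣ b ∣ → z * ι b ≡ c * ι a → c ∣ₚ z
  ∣ₚ-intro (+ zero) a p∤b _  = ⊥-elim (p∤b (p ∣0))
  ∣ₚ-intro +[1+ b ] a p∤b eq = multiple a b p∤b eq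
  ∣ₚ-intro {c} {z} -[1+ b ] a p∤b eq = multiple (ℤ.- a) b p∤b (begin
    z * ι (+ suc b)        ≡⟨ flip-sign z (ι (+ suc b)) ⟩
    - (z * - ι (+ suc b))  ≡⟨ cong (λ t → - (z * t)) (ι-neg (+ suc b)) ⟨
    - (z * ι -[1+ b ])     ≡⟨ cong -_ eq ⟩
    - (c * ι a)            ≡⟨ neg-*ʳ c (ι a) ⟩
    c * - ι a              ≡⟨ cong (c *_) (ι-neg a) ⟨
    c * ι (ℤ.- a)          ∎)
    where
    flip-sign : ∀ x y → x * y ≡ - (x * - y)
    flip-sign = Solver.solve-∀ ℚ-ring
    neg-*ʳ : ∀ x y → - (x * y) ≡ x * - y
    neg-*ʳ = Solver.solve-∀ ℚ-ring

  ∣ₚ-+ : ∀ {c z₁ z₂} → c ∣ₚ z₁ → c ∣ₚ z₂ → c ∣ₚ z₁ + z₂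
  ∣ₚ-+ {c} {z₁} {z₂} (multiple a₁ b₁ p∤b₁ e₁) (multiple a₂ b₂ p∤b₂ e₂) =
    ∣ₚ-intro (B₁ ℤ.* B₂) (a₁ ℤ.* B₂ ℤ.+ a₂ ℤ.* B₁) (∤-* B₁ B₂ p∤b₁ p∤b₂) (begin
      (z₁ + z₂) * ι (B₁ ℤ.* B₂)            ≡⟨ cong ((z₁ + z₂) *_) (ι-* B₁ B₂) ⟩
      (z₁ + z₂) * (ι B₁ * ι B₂)            ≡⟨ expand z₁ z₂ (ι B₁) (ι B₂) ⟩
      z₁ * ι B₁ * ι B₂ + z₂ * ι B₂ * ι B₁  ≡⟨ cong₂ (λ s t → s * ι B₂ + t * ι B₁) e₁ e₂ ⟩
      c * ι a₁ * ι B₂ + c * ι a₂ * ι B₁    ≡⟨ collect c (ι a₁) (ι B₂) (ι a₂) (ι B₁) ⟩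
      c * (ι a₁ * ι B₂ + ι a₂ * ι B₁)      ≡⟨ cong (c *_) (cong₂ _+_ (ι-* a₁ B₂) (ι-* a₂ B₁)) ⟨
      c * (ι (a₁ ℤ.* B₂) + ι (a₂ ℤ.* B₁))  ≡⟨ cong (c *_) (ι-+ (a₁ ℤ.* B₂) (a₂ ℤ.* B₁)) ⟨
      c * ι (a₁ ℤ.* B₂ ℤ.+ a₂ ℤ.* B₁)      ∎)
    where
    B₁ = + suc b₁
    B₂ = + suc b₂
    expand : ∀ x y u v → (x + y) * (u * v) ≡ x * u * v + y * v * u
    expand = Solver.solve-∀ ℚ-ring
    collect : ∀ c x u y v → c * x * u + c * y * v ≡ c * (x * u + y * v)
    collect = Solver.solve-∀ ℚ-ring

  ∣ₚ-neg : ∀ {c z} → c ∣ₚ z → c ∣ₚ - z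
  ∣ₚ-neg {c} {z} (multiple a b p∤b e) = multiple (ℤ.- a) b p∤b (begin
    - z * ι (+ suc b)    ≡⟨ neg-*ˡ z (ι (+ suc b)) ⟩
    - (z * ι (+ suc b))  ≡⟨ cong -_ e ⟩
    - (c * ι a)          ≡⟨ neg-*ʳ c (ι a) ⟩
    c * - ι a            ≡⟨ cong (c *_) (ι-neg a) ⟨
    c * ι (ℤ.- a)        ∎)
    where
    neg-*ˡ : ∀ x y → - x * y ≡ - (x * y)
    neg-*ˡ = Solver.solve-∀ ℚ-ring
    neg-*ʳ : ∀ x y → - (x * y) ≡ x * - y
    neg-*ʳ = Solver.solve-∀ ℚ-ring

  ∣ₚ-*ˡ : ∀ {c z} w → c ∣ₚ z → w * c ∣ₚ w * z
  ∣ₚ-*ˡ {c} {z} w (multiple a b p∤b e) = multiple a b p∤b (begin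
    w * z * ι (+ suc b)    ≡⟨ ℚ.*-assoc w z _ ⟩
    w * (z * ι (+ suc b))  ≡⟨ cong (w *_) e ⟩
    w * (c * ι a)          ≡⟨ ℚ.*-assoc w c (ι a) ⟨
    w * c * ι a            ∎)

  *∣ₚ⇒∣ₚ : ∀ {c w z} → Integral w → c * w ∣ₚ z → c ∣ₚ z
  *∣ₚ⇒∣ₚ {c} {w} {z} (multiple a′ b′ p∤b′ e′) (multiple a b p∤b e) =
    ∣ₚ-intro (B ℤ.* B′) (a ℤ.* a′) (∤-* B B′ p∤b p∤b′) (begin
      z * ι (B ℤ.* B′)       ≡⟨ cong (z *_) (ι-* B B′) ⟩
      z * (ι B * ι B′)       ≡⟨ ℚ.*-assoc z (ι B) (ι B′) ⟨
      z * ι B * ι B′         ≡⟨ cong (_* ι B′) e ⟩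
      c * w * ι a * ι B′     ≡⟨ regroup c w (ι a) (ι B′) ⟩
      c * ι a * (w * ι B′)   ≡⟨ cong (c * ι a *_) e′ ⟩
      c * ι a * (1ℚ * ι a′)  ≡⟨ drop-1 c (ι a) (ι a′) ⟩
      c * (ι a * ι a′)       ≡⟨ cong (c *_) (ι-* a a′) ⟨
      c * ι (a ℤ.* a′)       ∎)
    where
    B = + suc b
    B′ = + suc b′
    regroup : ∀ c w x y → c * w * x * y ≡ c * x * (w * y)
    regroup = Solver.solve-∀ ℚ-ring
    drop-1 : ∀ c x y → c * x * (1ℚ * y) ≡ c * (x * y)
    drop-1 = Solver.solve-∀ ℚ-ring

  integral-*-∣ₚ : ∀ {c w z} → Integral w → c ∣ₚ z → c ∣ₚ w * z
  integral-*-∣ₚ {c} {w} w∈ℤₚ c∣z = *∣ₚ⇒∣ₚ w∈ℤₚ (subst (_∣ₚ _) (ℚ.*-comm w c) (∣ₚ-*ˡ w c∣z))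

  integral-ι : ∀ i → Integral (ι i)
  integral-ι i = multiple i 0 p∤1 (ℚ.*-comm (ι i) 1ℚ)

  ≈-trans : ∀ {r x y z} → x ≈[ r ] y → y ≈[ r ] z → x ≈[ r ] z
  ≈-trans {r} {x} {y} {z} (close x≈y) (close y≈z) =
    close (subst (ι (+ p ^ r) ∣ₚ_) (telescope x y z) (∣ₚ-+ x≈y y≈z))
    where
    telescope : ∀ x y z → x - y + (y - z) ≡ x - z
    telescope = Solver.solve-∀ ℚ-ring

  ≈-weaken : ∀ {r x y} → x ≈[ suc r ] y → x ≈[ r ] y
  ≈-weaken {r} {x} {y} (close x≈y) = close (*∣ₚ⇒∣ₚ (integral-ι (+ p))
    (subst (_∣ₚ x - y) (trans (ι-ℕ-* p (p ^ r)) (ℚ.*-comm (ι (+ p)) (ι (+ p ^ r)))) x≈y))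

  ≈-* : ∀ {r x x′ y y′} → Integral x → Integral y′ → x ≈[ r ] x′ → y ≈[ r ] y′ → x * y ≈[ r ] x′ * y′
  ≈-* {r} {x} {x′} {y} {y′} x∈ℤₚ y′∈ℤₚ (close x≈x′) (close y≈y′) = close
    (subst (ι (+ p ^ r) ∣ₚ_) (split x x′ y y′)
      (∣ₚ-+ (integral-*-∣ₚ x∈ℤₚ y≈y′) (integral-*-∣ₚ y′∈ℤₚ x≈x′)))
    where
    split : ∀ x x′ y y′ → x * (y - y′) + y′ * (x - x′) ≡ x * y - x′ * y′
    split = Solver.solve-∀ ℚ-ring

  -- p ^ e ỹ ∈ ℤ₍ₚ₎ says ν(y) ≤ e; as ν(x − y) > e, also ν(x) = ν(y) ≤ e.
  integral-inverse : ∀ {e s x x̃ y ỹ} → x̃ * x ≡ 1ℚ → ỹ * y ≡ 1ℚ →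
                     Integral (ι (+ p ^ e) * ỹ) → x ≈[ e ℕ.+ suc s ] y → Integral (ι (+ p ^ e) * x̃)
  integral-inverse {e} {s} {x} {x̃} {y} {ỹ} x̃x≡1 ỹy≡1 (multiple a′ b′ p∤b′ ỹ-eq) (close (multiple a b p∤b x-y-eq)) =
    ∣ₚ-intro D (B ℤ.* a′) (∤-+-* (B ℤ.* B′) (a′ ℤ.* + p ^ s ℤ.* a) (∤-* B B′ p∤b p∤b′)) (begin
      Q * x̃ * ι D
        ≡⟨ cong (Q * x̃ *_) ι-D ⟩
      Q * x̃ * (ι B * ι B′ + ι a′ * S * ι a * ι (+ p))
        ≡⟨ integral-inverse-identity x x̃ y ỹ Q (ι B) (ι B′) (ι a) (ι a′) S (ι (+ p)) x̃x≡1 ỹy≡1 ỹ-eq′ x-y-eq′ ⟩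
      ι B * ι a′
        ≡⟨ trans (ℚ.*-identityˡ _) (ι-* B a′) ⟨
      1ℚ * ι (B ℤ.* a′)
        ∎)
    where
    B = + suc b
    B′ = + suc b′
    Q = ι (+ p ^ e)
    S = ι (+ p ^ s)
    D = B ℤ.* B′ ℤ.+ a′ ℤ.* + p ^ s ℤ.* a ℤ.* + p
    ι-D : ι D ≡ ι B * ι B′ + ι a′ * S * ι a * ι (+ p)
    ι-D = trans (ι-+ (B ℤ.* B′) (a′ ℤ.* + p ^ s ℤ.* a ℤ.* + p)) (cong₂ _+_ (ι-* B B′)
            (trans (ι-* (a′ ℤ.* + p ^ s ℤ.* a) (+ p))
              (cong (_* ι (+ p)) (trans (ι-* (a′ ℤ.* + p ^ s) a) (cong (_* ι a) (ι-* a′ (+ p ^ s)))))))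
    ỹ-eq′ : Q * ỹ * ι B′ ≡ ι a′
    ỹ-eq′ = trans ỹ-eq (ℚ.*-identityˡ (ι a′))
    x-y-eq′ : (x - y) * ι B ≡ Q * (ι (+ p) * S) * ι a
    x-y-eq′ = trans x-y-eq (cong (_* ι a) (trans (ι-^-+ p e (suc s)) (cong (Q *_) (ι-ℕ-* p (p ^ s)))))

  -- x̃ − ỹ = x̃ ỹ (y − x), and p ^ 2e x̃ ỹ ∈ ℤ₍ₚ₎ by integral-inverse.
  ≈-inverse : ∀ {e r x x̃ y ỹ} → x̃ * x ≡ 1ℚ → ỹ * y ≡ 1ℚ →
              Integral (ι (+ p ^ e) * ỹ) → x ≈[ e ℕ.+ suc (e ℕ.+ r) ] y → x̃ ≈[ r ] ỹ
  ≈-inverse {e} {r} {x} {x̃} {y} {ỹ} x̃x≡1 ỹy≡1 pᵉỹ∈ℤₚ x≈y@(close x-y∈pᴺℤₚ) = close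
    (*∣ₚ⇒∣ₚ (integral-*-∣ₚ (integral-*-∣ₚ pᵉx̃∈ℤₚ pᵉỹ∈ℤₚ) (integral-ι (+ p)))
      (subst₂ _∣ₚ_ scale difference (∣ₚ-*ˡ (x̃ * ỹ) (∣ₚ-neg x-y∈pᴺℤₚ))))
    where
    Q = ι (+ p ^ e)
    pᵉx̃∈ℤₚ : Integral (Q * x̃)
    pᵉx̃∈ℤₚ = integral-inverse x̃x≡1 ỹy≡1 pᵉỹ∈ℤₚ x≈y
    pᴺ : ι (+ p ^ (e ℕ.+ suc (e ℕ.+ r))) ≡ Q * (ι (+ p) * (Q * ι (+ p ^ r)))
    pᴺ = trans (ι-^-+ p e (suc (e ℕ.+ r)))
           (cong (Q *_) (trans (ι-ℕ-* p (p ^ (e ℕ.+ r))) (cong (ι (+ p) *_) (ι-^-+ p e r))))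
    scale : x̃ * ỹ * ι (+ p ^ (e ℕ.+ suc (e ℕ.+ r))) ≡ ι (+ p ^ r) * (Q * x̃ * (Q * ỹ) * ι (+ p))
    scale = trans (cong (x̃ * ỹ *_) pᴺ) (regroup x̃ ỹ Q (ι (+ p)) (ι (+ p ^ r)))
      where
      regroup : ∀ x̃ ỹ Q p pʳ → x̃ * ỹ * (Q * (p * (Q * pʳ))) ≡ pʳ * (Q * x̃ * (Q * ỹ) * p)
      regroup = Solver.solve-∀ ℚ-ring
    difference : x̃ * ỹ * - (x - y) ≡ x̃ - ỹ
    difference = begin
      x̃ * ỹ * - (x - y)          ≡⟨ expand x̃ ỹ x y ⟩
      x̃ * (ỹ * y) - ỹ * (x̃ * x)  ≡⟨ cong₂ (λ u v → x̃ * u - ỹ * v) ỹy≡1 x̃x≡1 ⟩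
      x̃ * 1ℚ - ỹ * 1ℚ            ≡⟨ cong₂ _-_ (ℚ.*-identityʳ x̃) (ℚ.*-identityʳ ỹ) ⟩
      x̃ - ỹ                      ∎
      where
      expand : ∀ x̃ ỹ x y → x̃ * ỹ * - (x - y) ≡ x̃ * (ỹ * y) - ỹ * (x̃ * x)
      expand = Solver.solve-∀ ℚ-ring

  natural-approximation : ∀ {z} → Integral z → ∀ r → ∃[ m ] m ≥ 1 × ι (+ m) ≈[ r ] z
  natural-approximation {z} (multiple a b p∤b z-eq) r =
    let m , m≥1 , c , mB-a≡pʳc = congruence-solution p∤b a r
    in m , m≥1 , close (multiple c b p∤b (begin
      (ι (+ m) - z) * ι B        ≡⟨ distrib (ι (+ m)) z (ι B) ⟩
      ι (+ m) * ι B - z * ι B    ≡⟨ cong (λ t → ι (+ m) * ι B - t) z-eq ⟩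
      ι (+ m) * ι B - 1ℚ * ι a   ≡⟨ cong (λ t → ι (+ m) * ι B - t) (ℚ.*-identityˡ (ι a)) ⟩
      ι (+ m) * ι B + - ι a      ≡⟨ cong₂ _+_ (ι-* (+ m) B) (ι-neg a) ⟨
      ι (+ m ℤ.* B) + ι (ℤ.- a)  ≡⟨ ι-+ (+ m ℤ.* B) (ℤ.- a) ⟨
      ι (+ m ℤ.* B ℤ.- a)        ≡⟨ cong ι mB-a≡pʳc ⟩
      ι (+ p ^ r ℤ.* c)          ≡⟨ ι-* (+ p ^ r) c ⟩
      ι (+ p ^ r) * ι c          ∎))
    where
    B = + suc b
    distrib : ∀ x z B → (x - z) * B ≡ x * B - z * B
    distrib = Solver.solve-∀ ℚ-ring

  p∤↧⇒integral : ∀ q → ¬ p ∣ ℚ.↧ₙ q → Integral q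
  p∤↧⇒integral q@(mkℚ u d _) p∤d+1 = multiple u d p∤d+1 (trans (*-denominator q) (sym (ℚ.*-identityˡ (ι u))))

  p∤↥⇒integral-1/ : ∀ q .{{_ : ℚ.NonZero q}} → ¬ p ∣ ℤ.∣ ℚ.↥ q ∣ → Integral (ℚ.1/ q)
  p∤↥⇒integral-1/ q@(mkℚ u d _) p∤u = ∣ₚ-intro u (+ suc d) p∤u (begin
    ℚ.1/ q * ι u                ≡⟨ cong (ℚ.1/ q *_) (*-denominator q) ⟨
    ℚ.1/ q * (q * ι (+ suc d))  ≡⟨ ℚ.*-assoc (ℚ.1/ q) q _ ⟨
    ℚ.1/ q * q * ι (+ suc d)    ≡⟨ cong (_* ι (+ suc d)) (ℚ.*-inverseˡ q) ⟩
    1ℚ * ι (+ suc d)            ∎)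

  ∃p^e*-integral : ∀ q → ∃[ e ] Integral (ι (+ p ^ e) * q)
  ∃p^e*-integral q@(mkℚ u d _) =
    let e , w , d+1≡pᵉw , p∤w = factor-p-power d
    in e , ∣ₚ-intro (+ w) u p∤w (begin
      ι (+ p ^ e) * q * ι (+ w)    ≡⟨ rotate (ι (+ p ^ e)) q (ι (+ w)) ⟩
      q * (ι (+ p ^ e) * ι (+ w))  ≡⟨ cong (q *_) (ι-ℕ-* (p ^ e) w) ⟨
      q * ι (+ (p ^ e ℕ.* w))      ≡⟨ cong (λ k → q * ι (+ k)) d+1≡pᵉw ⟨
      q * ι (+ suc d)              ≡⟨ *-denominator q ⟩
      ι u                          ≡⟨ ℚ.*-identityˡ (ι u) ⟨
      1ℚ * ι u                     ∎)
    where
    rotate : ∀ a b c → a * b * c ≡ b * (a * c)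
    rotate = Solver.solve-∀ ℚ-ring

  approximate-natural : ∀ {X} → pDenseInℕ p X → ∀ n → n ≥ 1 → ∀ r → ∃[ x ] X x × x ≈[ r ] ι (+ n)
  approximate-natural H n n≥1 r =
    let x , x∈X , x≈n = H n n≥1 (suc r) (s≤s z≤n)
    in x , x∈X , ≈-weaken (pClose⇒≈ (suc r) x (ι (+ n)) x≈n)

  approximate-integral : ∀ {X z} → pDenseInℕ p X → Integral z → ∀ r → ∃[ x ] X x × x ≈[ r ] z
  approximate-integral H z∈ℤₚ r =
    let m , m≥1 , m≈z = natural-approximation z∈ℤₚ r
        x , x∈X , x≈m = approximate-natural H m m≥1 r
    in x , x∈X , ≈-trans x≈m m≈z

  approximate-by-inverse : ∀ {X e q q̃} → pDenseInℕ p X → (∀ {x} → X x → ∃[ x̃ ] X x̃ × x̃ * x ≡ 1ℚ) →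
                           q * q̃ ≡ 1ℚ → Integral q̃ → Integral (ι (+ p ^ e) * q) →
                           ∀ r → ∃[ x ] X x × x ≈[ r ] q
  approximate-by-inverse {e = e} H X-inverse qq̃≡1 q̃∈ℤₚ pᵉq∈ℤₚ r =
    let x , x∈X , x≈q̃ = approximate-integral H q̃∈ℤₚ (e ℕ.+ suc (e ℕ.+ r))
        x̃ , x̃∈X , x̃x≡1 = X-inverse x∈X
    in x̃ , x̃∈X , ≈-inverse x̃x≡1 qq̃≡1 pᵉq∈ℤₚ x≈q̃

  ratio-approximation : ∀ {r a k n} → ι (+ a) ≈[ r ] ι (+ n) → ι (+ suc k) ≈[ suc r ] 1ℚ →
                        + a / suc k ≈[ r ] ι (+ n)
  ratio-approximation {r} {a} {k} {n} a≈n k+1≈1 =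
    subst₂ _≈[ r ]_ (sym (/-≡-ι-* (+ a) k)) (ℚ.*-identityʳ (ι (+ n)))
      (≈-* (integral-ι (+ a)) (integral-ι (+ 1)) a≈n
        (≈-inverse {e = 0} (/-*-ι (+ 1) k) refl (integral-ι (+ 1)) k+1≈1))

  naturals-dense⇒ratios-dense : ∀ {A} → (∀ a → A a → a ≥ 1) → pDenseInℕ p (toℚSet A) → pDenseInℕ p (R A)
  naturals-dense⇒ratios-dense {A} A⁺ H n n≥1 r r≥1 = approximate (H n n≥1 r r≥1) (H 1 (s≤s z≤n) (suc r) (s≤s z≤n))
    where
    approximate : ∃[ x ] toℚSet A x × pClose p r x (ι (+ n)) → ∃[ x ] toℚSet A x × pClose p (suc r) x 1ℚ →
                  ∃[ x ] R A x × pClose p r x (ι (+ n))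
    approximate _ (_ , (zero , 0∈A , _) , _) with A⁺ 0 0∈A
    ... | ()
    approximate (_ , (a , a∈A , refl) , a≈n) (_ , (suc k , k+1∈A , refl) , k+1≈1) =
      + a / suc k , (a , k , a∈A , k+1∈A , refl) ,
      ≈⇒pClose (ratio-approximation {r} {a} {k} {n}
        (pClose⇒≈ r (ι (+ a)) (ι (+ n)) a≈n) (pClose⇒≈ (suc r) (ι (+ suc k)) 1ℚ k+1≈1))

  ratios-dense-in-ℕ⇒ratios-dense-in-ℚₚ : ∀ {A} → (∀ a → A a → a ≥ 1) → pDenseInℕ p (R A) → pDenseInQp p (R A)
  ratios-dense-in-ℕ⇒ratios-dense-in-ℚₚ {A} A⁺ H q@(mkℚ u d u⊥d+1) r =
    let x , x∈RA , x≈q = approximate (p ∣? suc d) in x , x∈RA , ≈⇒pClose x≈q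
    where
    approximate : Dec (p ∣ suc d) → ∃[ x ] R A x × x ≈[ r ] q
    approximate (no p∤d+1) = approximate-integral H (p∤↧⇒integral q p∤d+1) r
    approximate (yes p∣d+1) =
      let e , pᵉq∈ℤₚ = ∃p^e*-integral q
      in approximate-by-inverse {e = e} H (R-inverse A⁺) (ℚ.*-inverseʳ q) (p∤↥⇒integral-1/ q p∤u) pᵉq∈ℤₚ r
      where
      p∤u : ¬ p ∣ ℤ.∣ u ∣
      p∤u p∣u = p∤1 (subst (p ∣_) (Coprimality.recompute u⊥d+1 (p∣u , p∣d+1)) ∣-refl)
      instance
        q≢0 : ℚ.NonZero q
        q≢0 = ℕ.≢-nonZero (λ ∣u∣≡0 → p∤u (subst (p ∣_) (sym ∣u∣≡0) (p ∣0)))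

lemma2p3 : (p : ℕ) → Prime p → (A : ℕ → Set) → ((a : ℕ) → A a → a ≥ 1) →
    (pDenseInℕ p (toℚSet A) → pDenseInQp p (R A))
    × (pDenseInℕ p (R A) → pDenseInQp p (R A))
lemma2p3 p p-prime A A⁺ = (λ H → ratios-dense (naturals-dense⇒ratios-dense A⁺ H)) , ratios-dense
  where
  open PAdic p p-prime
  ratios-dense : pDenseInℕ p (R A) → pDenseInQp p (R A)
  ratios-dense = ratios-dense-in-ℕ⇒ratios-dense-in-ℚₚ A⁺
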